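{- Let $n\geq 4$ and let $\mathbb{D}(n)$ be the twice-punctured disk with punctures $P,Q$ and $n-2$ marked points on the boundary. The quiver $\Gamma(\mathbb{D}(n))$ of interior arcs of $\mathbb{D}(n)$, with the translation $\tau([x,y])=[x^\ast,y^\ast]$, is a stable translation quiver (in the sense of Riedtmann) with exactly two connected components, and each connected component is a tube of rank $2$.
   Context: Interior arcs of $\mathbb{D}(n)$ are (generalized, i.e. possibly self-crossing) tagged curves, up to homotopy fixing endpoints, with both endpoints at the punctures $P,Q$; they may cut out a once-punctured monogon, in which case their two ends carry different tags. They are encoded as follows. Take the universal cover of a cylinder with one marked point $P$ on the lower boundary and one marked point $Q$ on the upper boundary: an infinite strip whose lower boundary carries the odd integers (preimages of $P$) and whose upper boundary carries the even integers (preimages of $Q$). For $a\in\mathbb{Z}\sqcup\mathbb{Z}^\ast$, $\|a\|\in\mathbb{Z}$ denotes the underlying integer, $\operatorname{tag}(a)$ is notched if $a\in\mathbb{Z}^\ast$ and plain otherwise, and $a^\ast$ denotes $a$ with its tag changed. The symbol $[x,y]$ denotes the arc in $\mathbb{D}(n)$ starting at the puncture corresponding to $x$, winding counterclockwise around both punctures $\lfloor |\,\|y\|-\|x\|\,|/2\rfloor$ times, and ending at the puncture corresponding to $y$, with the given tags at the ends. Each interior arc is written in normal form: $x\in\{0,0^\ast,1,1^\ast\}$, $y\in\mathbb{Z}_{>0}\sqcup(\mathbb{Z}_{>0})^\ast$, $\|x\|<\|y\|$; if $\|y\|-\|x\|$ is odd (an arc from $P$ to $Q$) then $\|x\|=0$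 when $\operatorname{tag}(x)=\operatorname{tag}(y)$ and $\|x\|=1$ when $\operatorname{tag}(x)\neq\operatorname{tag}(y)$; if $\|y\|-\|x\|$ is even (a loop cutting out a once-punctured monogon) then $\operatorname{tag}(x)\neq\operatorname{tag}(y)$. The vertices of $\Gamma(\mathbb{D}(n))$ are these arcs $[x,y]$ in normal form. There is an arrow $[x,y]\to[a,b]$ if: when $\|x\|=0$, either ($a=x$ and $b=y^\ast+1$) or ($a=x^\ast$ and $b=y-1$); when $\|x\|=1$, either ($a=x$ and $b=y+1$) or ($a=x^\ast$ and $b=y^\ast-1$). (Here $y\pm1$ shifts the integer and keeps the tag.) A stable translation quiver is a quiver with an automorphism $\tau$ such that for every vertex $v$ the set of (direct) predecessors of $v$ equals the set of successors of $\tau(v)$. A tube of rank $r$ is a stable translation quiver isomorphic to $\mathbb{Z}A_\infty/(\tau^r)$. -}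

module Defs where

open import Data.Nat using (ℕ; zero; suc; _+_; _∸_; _≤ᵇ_; _<ᵇ_; _≡ᵇ_; _%_; NonZero)
open import Data.Nat.DivMod using (_mod_)
open import Data.Bool using (Bool; true; false; not; _∧_; if_then_else_; T)
open import Data.Fin using (Fin; toℕ)
open import Data.Product using (Σ; ∃; _×_; _,_; proj₁; proj₂)
open import Data.Sum using (_⊎_)
open import Relation.Nullary using (¬_)
open import Relation.Binary.PropositionalEquality using (_≡_; refl; subst)
open import Relation.Binary.Construct.Closure.ReflexiveTransitive using (Star)

record TranslationQuiver : Set₁ where
  field
    Vertex : Set
    Arrow  : Vertex → Vertex → Set
    τ      : Vertex → Vertex

module _ (Q : TranslationQuiver) where
  open TranslationQuiver Q

  IsAutomorphismτ : Set
  IsAutomorphismτ =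
    (∀ u v → τ u ≡ τ v → u ≡ v) ×
    (∀ v → ∃ λ u → τ u ≡ v) ×
    (∀ u v → (Arrow u v → Arrow (τ u) (τ v)) × (Arrow (τ u) (τ v) → Arrow u v))

  IsStableTranslationQuiver : Set
  IsStableTranslationQuiver =
    IsAutomorphismτ ×
    (∀ v w → (Arrow w v → Arrow (τ v) w) × (Arrow (τ v) w → Arrow w v))

  Adjacent : Vertex → Vertex → Set
  Adjacent u v = Arrow u v ⊎ Arrow v u

  Connected : Vertex → Vertex → Set
  Connected = Star Adjacent

-- The tube of rank r:  ZA∞ / (τ^r)
-- ZA∞ has vertices (m , i) ∈ ℤ × ℕ, arrows (m , i) → (m , i+1) and
-- (m , i+1) → (m+1 , i), and τ (m , i) = (m-1 , i).  Quotienting by τ^r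
-- replaces m by its class in ℤ/r, represented by Fin r.

module _ (r : ℕ) .{{_ : NonZero r}} where

  TubeVertex : Set
  TubeVertex = Fin r × ℕ

  sucMod : Fin r → Fin r
  sucMod k = suc (toℕ k) mod r

  predMod : Fin r → Fin r
  predMod k = (toℕ k + (r ∸ 1)) mod r

  data TubeArrow : TubeVertex → TubeVertex → Set where
    up   : ∀ k i → TubeArrow (k , i) (k , suc i)
    down : ∀ k i → TubeArrow (k , suc i) (sucMod k , i)

  Tube : TranslationQuiver
  Tube = record
    { Vertex = TubeVertex
    ; Arrow  = TubeArrow
    ; τ      = λ { (k , i) → (predMod k , i) } }

module _ (Q : TranslationQuiver) where
  open TranslationQuiver Q

  ComponentIsomorphicTo : Vertex → TranslationQuiver → Set
  ComponentIsomorphicTo c T =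
    Σ (TranslationQuiver.Vertex T → Vertex) λ f →
      (∀ t → Connected Q c (f t)) ×
      (∀ s t → f s ≡ f t → s ≡ t) ×
      (∀ v → Connected Q c v → ∃ λ t → f t ≡ v) ×
      (∀ s t → (TranslationQuiver.Arrow T s t → Arrow (f s) (f t)) ×
               (Arrow (f s) (f t) → TranslationQuiver.Arrow T s t)) ×
      (∀ t → f (TranslationQuiver.τ T t) ≡ τ (f t))

  ComponentIsTube : Vertex → (r : ℕ) .{{_ : NonZero r}} → Set
  ComponentIsTube c r = ComponentIsomorphicTo c (Tube r)

-- Interior arcs of D(n), encoded as [x , y]
-- Tag: false = plain, true = notched.
-- x is encoded by (xv , xt) with ‖x‖ = xv, tag(x) = xt; similarly y.

record Arc : Set where
  constructor [_,_∣_,_]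
  field
    xv : ℕ
    xt : Bool
    yv : ℕ
    yt : Bool
open Arc public

sameTag : Bool → Bool → Bool
sameTag false false = true
sameTag true  true  = true
sameTag _     _     = false

sameTag-not : ∀ a b → sameTag (not a) (not b) ≡ sameTag a b
sameTag-not false false = refl
sameTag-not false true  = refl
sameTag-not true  false = refl
sameTag-not true  true  = refl

nfCond : ℕ → ℕ → Bool → Bool
nfCond x y s =
  if ((y ∸ x) % 2) ≡ᵇ 0
  then not s
  else (if s then x ≡ᵇ 0 else x ≡ᵇ 1)

isNF : Arc → Bool
isNF a = (xv a ≤ᵇ 1) ∧ (xv a <ᵇ yv a) ∧ nfCond (xv a) (yv a) (sameTag (xt a) (yt a))

GVertex : Set
GVertex = Σ Arc (λ a → T (isNF a))

-- Arrows of Γ(D(n)).  Here y*+1 has underlying integer ‖y‖+1 and tag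
-- opposite to y; "b = y - 1" is written suc ‖b‖ ≡ ‖y‖.
ArcArrow : Arc → Arc → Set
ArcArrow [ zero , xt' ∣ y , yt' ] [ a , at ∣ b , bt ] =
  (a ≡ zero × at ≡ xt' × b ≡ suc y × bt ≡ not yt') ⊎
  (a ≡ zero × at ≡ not xt' × suc b ≡ y × bt ≡ yt')
ArcArrow [ suc x , xt' ∣ y , yt' ] [ a , at ∣ b , bt ] =
  (a ≡ suc x × at ≡ xt' × b ≡ suc y × bt ≡ yt') ⊎
  (a ≡ suc x × at ≡ not xt' × suc b ≡ y × bt ≡ not yt')

GArrow : GVertex → GVertex → Set
GArrow u v = ArcArrow (proj₁ u) (proj₁ v)

flipArc : Arc → Arc
flipArc [ x , xt' ∣ y , yt' ] = [ x , not xt' ∣ y , not yt' ]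

isNF-flip : ∀ a → isNF (flipArc a) ≡ isNF a
isNF-flip [ x , xt' ∣ y , yt' ] rewrite sameTag-not xt' yt' = refl

Gτ : GVertex → GVertex
Gτ (a , p) = flipArc a , subst T (Relation.Binary.PropositionalEquality.sym (isNF-flip a)) p

-- The translation quiver Γ(D(n)).  The combinatorial description in the
-- paper does not depend on n (n only enters through the geometry of D(n)).
Γ : ℕ → TranslationQuiver
Γ n = record { Vertex = GVertex ; Arrow = GArrow ; τ = Gτ }

{-# OPTIONS --safe #-}

-- Every arrow of Γ keeps ‖x‖ ∈ {0, 1} fixed, and once ‖x‖ is known the normal
-- form makes tag(y) a function of tag(x) and ‖y‖.  Hence each of the classes
-- ‖x‖ = 0 and ‖x‖ = 1 is parametrised by (tag(x), ‖y‖ − ‖x‖ − 1) ∈ ℤ/2 × ℕ; in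
-- these coordinates raising ‖y‖ keeps tag(x) and lowering it flips tag(x), which
-- are exactly the arrows of ZA∞/(τ²), and τ flips tag(x).  The tube being
-- connected, the two classes are the two components.  Stability holds because
-- τ is an involution preserving arrows and every arrow w → v yields τ v → w.
module Submission where

open import Defs
open import Data.Bool using (Bool; true; false; not; T; _xor_)
open import Data.Bool.Properties using (not-involutive; not-distribˡ-xor; not-distribʳ-xor; T-irrelevant)
open import Data.Fin using (Fin; toℕ; fromℕ<)
open import Data.Fin.Properties using (fromℕ<-toℕ; toℕ-fromℕ<; fromℕ<-cong; toℕ<n)
open import Data.Nat using (ℕ; zero; suc; _≤_; _<_; _%_; _≡ᵇ_; _∸_)
open import Data.Nat.DivMod using (m<n⇒m%n≡m)
open import Data.Nat.Properties using (<-trans; n<1+n; 0≢1+n)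
open import Data.Product using (Σ; _×_; _,_; proj₁)
open import Data.Sum using (_⊎_; inj₁; inj₂)
import Data.Sum as Sum
open import Relation.Nullary using (¬_)
open import Relation.Binary.PropositionalEquality
open import Relation.Binary.Construct.Closure.ReflexiveTransitive using (ε; _◅_; _◅◅_; gmap)

module _ {Q : TranslationQuiver} where
  open TranslationQuiver Q

  Connected-invariant : ∀ {A : Set} (h : Vertex → A) → (∀ {u v} → Arrow u v → h u ≡ h v) →
                        ∀ {u v} → Connected Q u v → h u ≡ h v
  Connected-invariant h h-arrow ε              = refl
  Connected-invariant h h-arrow (inj₁ a ◅ path) = trans (h-arrow a) (Connected-invariant h h-arrow path)
  Connected-invariant h h-arrow (inj₂ a ◅ path) = trans (sym (h-arrow a)) (Connected-invariant h h-arrow path)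

  involution-isStable : (∀ v → τ (τ v) ≡ v) →
                        (∀ {u v} → Arrow u v → Arrow (τ u) (τ v)) →
                        (∀ {v w} → Arrow w v → Arrow (τ v) w) →
                        IsStableTranslationQuiver Q
  involution-isStable τ-involutive τ-arrow mesh =
    (τ-injective , (λ v → τ v , τ-involutive v) , λ _ _ → τ-arrow , τ-reflect) ,
    λ _ _ → mesh , λ a → τ-reflect (mesh a)
    where
    τ-injective : ∀ u v → τ u ≡ τ v → u ≡ v
    τ-injective u v eq = trans (sym (τ-involutive u)) (trans (cong τ eq) (τ-involutive v))

    τ-reflect : ∀ {u v} → Arrow (τ u) (τ v) → Arrow u v
    τ-reflect {u} {v} a = subst₂ Arrow (τ-involutive u) (τ-involutive v) (τ-arrow a)

module _ {S Q : TranslationQuiver} where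
  private
    module S = TranslationQuiver S
    module Q = TranslationQuiver Q

  Connected-map : (f : S.Vertex → Q.Vertex) → (∀ {s t} → S.Arrow s t → Q.Arrow (f s) (f t)) →
                  ∀ {s t} → Connected S s t → Connected Q (f s) (f t)
  Connected-map f f-arrow = gmap f (Sum.map f-arrow f-arrow)

  componentIsomorphicTo-byInverse :
    (f : S.Vertex → Q.Vertex) (g : Q.Vertex → S.Vertex) (s₀ : S.Vertex) →
    (∀ s → Connected S s₀ s) →
    (∀ {s t} → S.Arrow s t → Q.Arrow (f s) (f t)) →
    (∀ u v → Q.Arrow u v → S.Arrow (g u) (g v)) →
    (∀ s → f (S.τ s) ≡ Q.τ (f s)) →
    (∀ s → g (f s) ≡ s) →
    (∀ v → Connected Q (f s₀) v → f (g v) ≡ v) →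
    ComponentIsomorphicTo Q (f s₀) S
  componentIsomorphicTo-byInverse f g s₀ S-connected f-arrow g-arrow f-τ g∘f f∘g =
    f ,
    (λ s → Connected-map f f-arrow (S-connected s)) ,
    (λ s t eq → trans (sym (g∘f s)) (trans (cong g eq) (g∘f t))) ,
    (λ v path → g v , f∘g v path) ,
    (λ s t → f-arrow , λ a → subst₂ S.Arrow (g∘f s) (g∘f t) (g-arrow (f s) (f t) a)) ,
    f-τ

module _ {r : ℕ} where
  private
    𝕋 : TranslationQuiver
    𝕋 = Tube (suc r)

  down′ : ∀ {k k′ i} → k′ ≡ sucMod (suc r) k → TubeArrow (suc r) (k , suc i) (k′ , i)
  down′ refl = down _ _

  sucMod-fromℕ< : ∀ {j} (j<1+r : j < suc r) (1+j<1+r : suc j < suc r) →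
                  sucMod (suc r) (fromℕ< j<1+r) ≡ fromℕ< 1+j<1+r
  sucMod-fromℕ< {j} j<1+r 1+j<1+r = fromℕ<-cong _ (suc j) 1+j%1+r≡1+j _ 1+j<1+r
    where
    1+j%1+r≡1+j : suc (toℕ (fromℕ< j<1+r)) % suc r ≡ suc j
    1+j%1+r≡1+j rewrite toℕ-fromℕ< j<1+r = m<n⇒m%n≡m 1+j<1+r

  Tube-column : ∀ k i → Connected 𝕋 (k , 0) (k , i)
  Tube-column k zero    = ε
  Tube-column k (suc i) = Tube-column k i ◅◅ inj₁ (up k i) ◅ ε

  Tube-mouth : ∀ j (j<1+r : j < suc r) → Connected 𝕋 (Fin.zero , 0) (fromℕ< j<1+r , 0)
  Tube-mouth zero    _       = ε
  Tube-mouth (suc j) 1+j<1+r =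
    Tube-mouth j j<1+r ◅◅
    subst (λ k → Connected 𝕋 (fromℕ< j<1+r , 0) (k , 0)) (sucMod-fromℕ< j<1+r 1+j<1+r)
      (inj₁ (up _ 0) ◅ inj₁ (down _ 0) ◅ ε)
    where
    j<1+r : j < suc r
    j<1+r = <-trans (n<1+n j) 1+j<1+r

  Tube-connected : ∀ t → Connected 𝕋 (Fin.zero , 0) t
  Tube-connected (k , i) =
    subst (λ k′ → Connected 𝕋 (Fin.zero , 0) (k′ , 0)) (fromℕ<-toℕ k (toℕ<n k))
      (Tube-mouth (toℕ k) (toℕ<n k))
    ◅◅ Tube-column k i

toBool : Fin 2 → Bool
toBool Fin.zero           = false
toBool (Fin.suc Fin.zero) = true

fromBool : Bool → Fin 2
fromBool false = Fin.zero
fromBool true  = Fin.suc Fin.zero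

fromBool-toBool : ∀ k → fromBool (toBool k) ≡ k
fromBool-toBool Fin.zero           = refl
fromBool-toBool (Fin.suc Fin.zero) = refl

toBool-fromBool : ∀ b → toBool (fromBool b) ≡ b
toBool-fromBool false = refl
toBool-fromBool true  = refl

toBool-sucMod : ∀ k → toBool (sucMod 2 k) ≡ not (toBool k)
toBool-sucMod Fin.zero           = refl
toBool-sucMod (Fin.suc Fin.zero) = refl

toBool-predMod : ∀ k → toBool (predMod 2 k) ≡ not (toBool k)
toBool-predMod Fin.zero           = refl
toBool-predMod (Fin.suc Fin.zero) = refl

fromBool-not : ∀ b → fromBool (not b) ≡ sucMod 2 (fromBool b)
fromBool-not false = refl
fromBool-not true  = refl

GVertex-≡ : ∀ {a b : Arc} {p : T (isNF a)} {q : T (isNF b)} → a ≡ b → (a , p) ≡ (b , q)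
GVertex-≡ {a} refl = cong (a ,_) (T-irrelevant _ _)

flipArc-involutive : ∀ a → flipArc (flipArc a) ≡ a
flipArc-involutive [ x , s ∣ y , t ] =
  cong₂ (λ s′ t′ → [ x , s′ ∣ y , t′ ]) (not-involutive s) (not-involutive t)

flipArc-arrow : ∀ {a b} → ArcArrow a b → ArcArrow (flipArc a) (flipArc b)
flipArc-arrow {[ zero  , _ ∣ _ , _ ]} (inj₁ (refl , refl , refl , refl)) = inj₁ (refl , refl , refl , refl)
flipArc-arrow {[ zero  , _ ∣ _ , _ ]} (inj₂ (refl , refl , refl , refl)) = inj₂ (refl , refl , refl , refl)
flipArc-arrow {[ suc _ , _ ∣ _ , _ ]} (inj₁ (refl , refl , refl , refl)) = inj₁ (refl , refl , refl , refl)
flipArc-arrow {[ suc _ , _ ∣ _ , _ ]} (inj₂ (refl , refl , refl , refl)) = inj₂ (refl , refl , refl , refl)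

ArcArrow-mesh : ∀ {a b} → ArcArrow b a → ArcArrow (flipArc a) b
ArcArrow-mesh {b = [ zero  , s ∣ _ , t ]} (inj₁ (refl , refl , refl , refl)) =
  inj₂ (refl , sym (not-involutive s) , refl , sym (not-involutive t))
ArcArrow-mesh {b = [ zero  , s ∣ _ , t ]} (inj₂ (refl , refl , refl , refl)) =
  inj₁ (refl , sym (not-involutive s) , refl , sym (not-involutive t))
ArcArrow-mesh {b = [ suc _ , s ∣ _ , t ]} (inj₁ (refl , refl , refl , refl)) =
  inj₂ (refl , sym (not-involutive s) , refl , sym (not-involutive t))
ArcArrow-mesh {b = [ suc _ , s ∣ _ , t ]} (inj₂ (refl , refl , refl , refl)) =
  inj₁ (refl , sym (not-involutive s) , refl , sym (not-involutive t))

Γ-isStable : ∀ n → IsStableTranslationQuiver (Γ n)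
Γ-isStable n =
  involution-isStable (λ v → GVertex-≡ (flipArc-involutive (proj₁ v))) flipArc-arrow ArcArrow-mesh

ArcArrow-xv : ∀ {a b} → ArcArrow a b → xv a ≡ xv b
ArcArrow-xv {[ zero  , _ ∣ _ , _ ]} (inj₁ (refl , _)) = refl
ArcArrow-xv {[ zero  , _ ∣ _ , _ ]} (inj₂ (refl , _)) = refl
ArcArrow-xv {[ suc _ , _ ∣ _ , _ ]} (inj₁ (refl , _)) = refl
ArcArrow-xv {[ suc _ , _ ∣ _ , _ ]} (inj₂ (refl , _)) = refl

Connected-xv : ∀ {n u v} → Connected (Γ n) u v → xv (proj₁ u) ≡ xv (proj₁ v)
Connected-xv {n} = Connected-invariant {Γ n} (λ v → xv (proj₁ v)) ArcArrow-xv

toTube : GVertex → TubeVertex 2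
toTube (a , _) = fromBool (xt a) , yv a ∸ suc (xv a)

toTube-arrow : ∀ u v → GArrow u v → TubeArrow 2 (toTube u) (toTube v)
toTube-arrow ([ zero , s ∣ suc y , _ ] , _) _ (inj₁ (refl , refl , refl , refl)) = up (fromBool s) y
toTube-arrow ([ zero , s ∣ suc (suc y) , _ ] , _) _ (inj₂ (refl , refl , refl , refl)) = down′ (fromBool-not s)
toTube-arrow ([ zero , _ ∣ suc zero , _ ] , _) (_ , ()) (inj₂ (refl , refl , refl , refl))
toTube-arrow ([ zero , _ ∣ zero , _ ] , ()) _
toTube-arrow ([ suc zero , s ∣ suc (suc y) , _ ] , _) _ (inj₁ (refl , refl , refl , refl)) = up (fromBool s) y
toTube-arrow ([ suc zero , s ∣ suc (suc (suc y)) , _ ] , _) _ (inj₂ (refl , refl , refl , refl)) = down′ (fromBool-not s)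
toTube-arrow ([ suc zero , _ ∣ suc (suc zero) , _ ] , _) (_ , ()) (inj₂ (refl , refl , refl , refl))
toTube-arrow ([ suc zero , _ ∣ suc zero , _ ] , ()) _
toTube-arrow ([ suc zero , _ ∣ zero , _ ] , ()) _
toTube-arrow ([ suc (suc _) , _ ∣ _ , _ ] , ()) _

-- Since ‖y‖ ∸ ‖x‖ = suc i for the arcs [ 0 , suc i ] and [ 1 , suc (suc i) ], their
-- normal-form condition branches on oddᵇ i definitionally.
oddᵇ : ℕ → Bool
oddᵇ i = suc i % 2 ≡ᵇ 0

oddᵇ-suc : ∀ i → oddᵇ (suc i) ≡ not (oddᵇ i)
oddᵇ-suc 0             = refl
oddᵇ-suc 1             = refl
oddᵇ-suc (suc (suc i)) = oddᵇ-suc i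

xor-oddᵇ-suc : ∀ t i → t xor oddᵇ (suc i) ≡ not (t xor oddᵇ i)
xor-oddᵇ-suc t i = trans (cong (t xor_) (oddᵇ-suc i)) (sym (not-distribʳ-xor t (oddᵇ i)))

isNF₀ : ∀ s i → T (isNF [ 0 , s ∣ suc i , s xor oddᵇ i ])
isNF₀ s i with oddᵇ i
isNF₀ false i | false = _
isNF₀ false i | true  = _
isNF₀ true  i | false = _
isNF₀ true  i | true  = _

isNF₀⇒yt : ∀ s t i → T (isNF [ 0 , s ∣ suc i , t ]) → t ≡ s xor oddᵇ i
isNF₀⇒yt s t i nf with oddᵇ i
isNF₀⇒yt false false i _  | false = refl
isNF₀⇒yt false true  i () | false
isNF₀⇒yt true  false i () | false
isNF₀⇒yt true  true  i _  | false = refl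
isNF₀⇒yt false false i () | true
isNF₀⇒yt false true  i _  | true  = refl
isNF₀⇒yt true  false i _  | true  = refl
isNF₀⇒yt true  true  i () | true

isNF₁ : ∀ s i → T (isNF [ 1 , s ∣ suc (suc i) , not s ])
isNF₁ s i with oddᵇ i
isNF₁ false i | false = _
isNF₁ false i | true  = _
isNF₁ true  i | false = _
isNF₁ true  i | true  = _

isNF₁⇒yt : ∀ s t i → T (isNF [ 1 , s ∣ suc (suc i) , t ]) → t ≡ not s
isNF₁⇒yt false true  i _ = refl
isNF₁⇒yt true  false i _ = refl
isNF₁⇒yt false false i nf with oddᵇ i
isNF₁⇒yt false false i () | false
isNF₁⇒yt false false i () | true
isNF₁⇒yt true  true  i nf with oddᵇ i
isNF₁⇒yt true  true  i () | false
isNF₁⇒yt true  true  i () | true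

arc₀ : TubeVertex 2 → GVertex
arc₀ (k , i) = [ 0 , toBool k ∣ suc i , toBool k xor oddᵇ i ] , isNF₀ (toBool k) i

arc₁ : TubeVertex 2 → GVertex
arc₁ (k , i) = [ 1 , toBool k ∣ suc (suc i) , not (toBool k) ] , isNF₁ (toBool k) i

arc₀-arrow : ∀ {s t} → TubeArrow 2 s t → GArrow (arc₀ s) (arc₀ t)
arc₀-arrow (up k i)   = inj₁ (refl , refl , refl , xor-oddᵇ-suc (toBool k) i)
arc₀-arrow (down k i) = inj₂ (refl , toBool-sucMod k , refl , yt-down)
  where
  open ≡-Reasoning
  yt-down : toBool (sucMod 2 k) xor oddᵇ i ≡ toBool k xor oddᵇ (suc i)
  yt-down = begin
    toBool (sucMod 2 k) xor oddᵇ i  ≡⟨ cong (_xor oddᵇ i) (toBool-sucMod k) ⟩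
    not (toBool k) xor oddᵇ i       ≡⟨ not-distribˡ-xor (toBool k) (oddᵇ i) ⟨
    not (toBool k xor oddᵇ i)       ≡⟨ xor-oddᵇ-suc (toBool k) i ⟨
    toBool k xor oddᵇ (suc i)       ∎

arc₁-arrow : ∀ {s t} → TubeArrow 2 s t → GArrow (arc₁ s) (arc₁ t)
arc₁-arrow (up k i)   = inj₁ (refl , refl , refl , refl)
arc₁-arrow (down k i) = inj₂ (refl , toBool-sucMod k , refl , cong not (toBool-sucMod k))

arc₀-τ : ∀ s → arc₀ (TranslationQuiver.τ (Tube 2) s) ≡ Gτ (arc₀ s)
arc₀-τ (k , i) = GVertex-≡ (cong₂ (λ s t → [ 0 , s ∣ suc i , t ]) (toBool-predMod k)
  (trans (cong (_xor oddᵇ i) (toBool-predMod k)) (sym (not-distribˡ-xor (toBool k) (oddᵇ i)))))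

arc₁-τ : ∀ s → arc₁ (TranslationQuiver.τ (Tube 2) s) ≡ Gτ (arc₁ s)
arc₁-τ (k , i) = GVertex-≡ (cong₂ (λ s t → [ 1 , s ∣ suc (suc i) , t ])
  (toBool-predMod k) (cong not (toBool-predMod k)))

toTube-arc₀ : ∀ s → toTube (arc₀ s) ≡ s
toTube-arc₀ (k , i) = cong (_, i) (fromBool-toBool k)

toTube-arc₁ : ∀ s → toTube (arc₁ s) ≡ s
toTube-arc₁ (k , i) = cong (_, i) (fromBool-toBool k)

arc₀-toTube : ∀ v → xv (proj₁ v) ≡ 0 → arc₀ (toTube v) ≡ v
arc₀-toTube ([ zero , _ ∣ zero , _ ] , ()) refl
arc₀-toTube ([ suc _ , _ ∣ _ , _ ] , _) ()
arc₀-toTube ([ zero , s ∣ suc i , t ] , nf) refl =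
  GVertex-≡ (cong₂ (λ s′ t′ → [ 0 , s′ ∣ suc i , t′ ]) (toBool-fromBool s)
    (trans (cong (_xor oddᵇ i) (toBool-fromBool s)) (sym (isNF₀⇒yt s t i nf))))

arc₁-toTube : ∀ v → xv (proj₁ v) ≡ 1 → arc₁ (toTube v) ≡ v
arc₁-toTube ([ zero , _ ∣ _ , _ ] , _) ()
arc₁-toTube ([ suc (suc _) , _ ∣ _ , _ ] , _) ()
arc₁-toTube ([ suc zero , _ ∣ zero , _ ] , ()) refl
arc₁-toTube ([ suc zero , _ ∣ suc zero , _ ] , ()) refl
arc₁-toTube ([ suc zero , s ∣ suc (suc i) , t ] , nf) refl =
  GVertex-≡ (cong₂ (λ s′ t′ → [ 1 , s′ ∣ suc (suc i) , t′ ]) (toBool-fromBool s)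
    (trans (cong not (toBool-fromBool s)) (sym (isNF₁⇒yt s t i nf))))

module _ (n : ℕ) where

  component₀-isTube : ComponentIsTube (Γ n) (arc₀ (Fin.zero , 0)) 2
  component₀-isTube =
    componentIsomorphicTo-byInverse {Tube 2} {Γ n} arc₀ toTube (Fin.zero , 0)
      Tube-connected arc₀-arrow toTube-arrow arc₀-τ toTube-arc₀
      (λ v path → arc₀-toTube v (sym (Connected-xv {n} path)))

  component₁-isTube : ComponentIsTube (Γ n) (arc₁ (Fin.zero , 0)) 2
  component₁-isTube =
    componentIsomorphicTo-byInverse {Tube 2} {Γ n} arc₁ toTube (Fin.zero , 0)
      Tube-connected arc₁-arrow toTube-arrow arc₁-τ toTube-arc₁
      (λ v path → arc₁-toTube v (sym (Connected-xv {n} path)))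

  Γ-components : ∀ v → Connected (Γ n) (arc₀ (Fin.zero , 0)) v ⊎
                       Connected (Γ n) (arc₁ (Fin.zero , 0)) v
  Γ-components v@([ zero , _ ∣ _ , _ ] , _) =
    inj₁ (subst (Connected (Γ n) _) (arc₀-toTube v refl)
      (Connected-map {Tube 2} {Γ n} arc₀ arc₀-arrow (Tube-connected (toTube v))))
  Γ-components v@([ suc zero , _ ∣ _ , _ ] , _) =
    inj₂ (subst (Connected (Γ n) _) (arc₁-toTube v refl)
      (Connected-map {Tube 2} {Γ n} arc₁ arc₁-arrow (Tube-connected (toTube v))))
  Γ-components ([ suc (suc _) , _ ∣ _ , _ ] , ())

mainTheorem1 : (n : ℕ) → 4 ≤ n →
    IsStableTranslationQuiver (Γ n) ×
    Σ GVertex (λ c₁ → Σ GVertex (λ c₂ →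
      (¬ Connected (Γ n) c₁ c₂) ×
      ((v : GVertex) → Connected (Γ n) c₁ v ⊎ Connected (Γ n) c₂ v) ×
      ComponentIsTube (Γ n) c₁ 2 ×
      ComponentIsTube (Γ n) c₂ 2))
-- Γ n does not depend on n.
mainTheorem1 n _ =
  Γ-isStable n ,
  arc₀ (Fin.zero , 0) , arc₁ (Fin.zero , 0) ,
  (λ path → 0≢1+n (Connected-xv {n} path)) ,
  Γ-components n ,
  component₀-isTube n ,
  component₁-isTube n
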